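{- Let $n\ge 3$ and let $(1,1,L_3,\dots,L_n)$ be a sequence of links, with $L_k\in\{1,2,3\}$ for each $k\ge 3$. Suppose that, at each step of the construction of the squares $1,2,\dots,n$ according to these links, the two ending vertices of the most recently added square have degree $2$ in the graph formed by the squares placed so far. Then the sequence $(1,1,L_3,\dots,L_n)$ is globally realizable.
   Context: A polyomino system is a finite, 2-connected planar graph in which every interior face (a cell) is a unit square. Its inner dual graph has one vertex per cell, two vertices adjacent iff the cells share an edge. A general polyomino chain is a polyomino system whose inner dual graph is a path; equivalently it is built by adding unit squares one at a time (square $i+1$ glued along one side to square $i$), in the order of that path. Construction from links: square $1$ is a unit square in $\mathbb{R}^2$ and square $2$ is attached to the right of square $1$. For $i\ge 2$ square $i$ is called horizontal (resp. vertical) if it was attached to the right/left (resp. above/below) of square $i-1$; its orientation is the corresponding element of $\{R,L,U,D\}$ (square 2 is horizontal with orientation $R$). For $i\ge2$ the link $L_{i+1}$ governs the placement of square $i+1$, attached along a side of square $i$: $L_{i+1}=1$ means square $i+1$ has the same direction as square $i$ (continuing straight); otherwise square $i+1$ has the other direction, and letting $j=\max\{1<\ell<i:\ \text{direction of square }\ell\neq\text{direction of square }i\}$: if $j$ does not exist then $L_{i+1}=2$; if $j$ exists and the orientation of square $i+1$ equals that of square $j$ then $L_{i+1}=2$; otherwise $L_{i+1}=3$. The convention $L_1=L_2=1$ is used. A sequence of links is globally realizable (valid) if the resulting construction forms a general polyomino chain. When square $i+1$ is attached to square $i$ along one of its sides, the two vertices of square $i+1$ not on that side are its ending vertices. -}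

module Defs where

open import Data.Nat using (ℕ; zero; suc; _+_; _∸_; _≤_; _<_)
open import Data.Integer as ℤ using (ℤ; +_; -[1+_]) renaming (_+_ to _+ℤ_; _-_ to _-ℤ_; _<_ to _<ℤ_)
open import Data.Integer.Properties as ℤP using ()
open import Data.Bool using (Bool; true; false; _∧_; _∨_; if_then_else_; not)
open import Data.Maybe using (Maybe; just; nothing)
open import Data.Product using (_×_; _,_; proj₁; proj₂; ∃-syntax)
open import Relation.Nullary using (¬_)
open import Relation.Nullary.Decidable using (⌊_⌋)
open import Relation.Binary.PropositionalEquality using (_≡_)

-- Grid cells.  A unit square is identified with its lower-left corner.

Point : Set
Point = ℤ × ℤ

Cell : Set
Cell = ℤ × ℤ

_=ℤ_ : ℤ → ℤ → Bool
a =ℤ b = ⌊ a ℤP.≟ b ⌋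

_=P_ : Point → Point → Bool
(a , b) =P (c , d) = (a =ℤ c) ∧ (b =ℤ d)

data Orient : Set where
  R L U D : Orient

data Dir : Set where
  horizontal vertical : Dir

dir : Orient → Dir
dir R = horizontal
dir L = horizontal
dir U = vertical
dir D = vertical

_=O_ : Orient → Orient → Bool
R =O R = true
L =O L = true
U =O U = true
D =O D = true
_ =O _ = false

_=D_ : Dir → Dir → Bool
horizontal =D horizontal = true
vertical   =D vertical   = true
_          =D _          = false

-- A placement: o k is the orientation of square k (k ≥ 2).
Placement : Set
Placement = ℕ → Orient

lastOtherDir : Placement → Dir → ℕ → Maybe ℕ
lastOtherDir o d zero = nothing
lastOtherDir o d (suc zero) = nothing
lastOtherDir o d (suc (suc k)) =
  if not (dir (o (suc (suc k))) =D d) then just (suc (suc k))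
  else lastOtherDir o d (suc k)

-- Value 0 signals that square
-- i+1 reverses square i (same direction, opposite orientation), which no
-- link in {1,2,3} describes.
linkOf : Placement → ℕ → ℕ
linkOf o i =
  if o (suc i) =O o i then 1
  else if dir (o (suc i)) =D dir (o i) then 0
  else helper (lastOtherDir o (dir (o i)) (i ∸ 1))
  where
    helper : Maybe ℕ → ℕ
    helper nothing  = 2
    helper (just j) = if o (suc i) =O o j then 2 else 3

Follows : ℕ → (ℕ → ℕ) → Placement → Set
Follows n Lk o = (o 2 ≡ R) × (∀ i → 2 ≤ i → i < n → linkOf o i ≡ Lk (suc i))

move : Orient → Cell → Cell
move R (x , y) = (x +ℤ + 1 , y)
move L (x , y) = (x -ℤ + 1 , y)
move U (x , y) = (x , y +ℤ + 1)
move D (x , y) = (x , y -ℤ + 1)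

pos : Placement → ℕ → Cell
pos o zero = (+ 0 , + 0)
pos o (suc zero) = (+ 0 , + 0)
pos o (suc (suc k)) = move (o (suc (suc k))) (pos o (suc k))

-- The graph formed by squares 1..k: vertices are lattice points, edges are
-- unit segments that are sides of some placed square.

data Seg : Set where
  hseg : Point → Seg   -- from (x,y) to (x+1,y)
  vseg : Point → Seg   -- from (x,y) to (x,y+1)

_=S_ : Seg → Seg → Bool
hseg p =S hseg q = p =P q
vseg p =S vseg q = p =P q
_ =S _ = false

isSideOf : Seg → Cell → Bool
isSideOf s (x , y) =
  (s =S hseg (x , y)) ∨ (s =S hseg (x , y +ℤ + 1)) ∨
  (s =S vseg (x , y)) ∨ (s =S vseg (x +ℤ + 1 , y))

anyUpTo : (ℕ → Bool) → ℕ → Bool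
anyUpTo f zero = false
anyUpTo f (suc k) = f (suc k) ∨ anyUpTo f k

isEdge : Placement → ℕ → Seg → Bool
isEdge o k s = anyUpTo (λ i → isSideOf s (pos o i)) k

b2n : Bool → ℕ
b2n true = 1
b2n false = 0

degree : Placement → ℕ → Point → ℕ
degree o k (x , y) =
  b2n (isEdge o k (hseg (x , y))) + b2n (isEdge o k (hseg (x -ℤ + 1 , y))) +
  b2n (isEdge o k (vseg (x , y))) + b2n (isEdge o k (vseg (x , y -ℤ + 1)))

-- The two ending vertices of square k (k ≥ 2): the corners of square k not
-- on the side shared with square k-1.
endingVertices : Placement → ℕ → Point × Point
endingVertices o k with o k | pos o k
... | R | (x , y) = (x +ℤ + 1 , y) , (x +ℤ + 1 , y +ℤ + 1)
... | L | (x , y) = (x , y) , (x , y +ℤ + 1)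
... | U | (x , y) = (x , y +ℤ + 1) , (x +ℤ + 1 , y +ℤ + 1)
... | D | (x , y) = (x , y) , (x +ℤ + 1 , y)

EndingDegreeTwo : ℕ → Placement → Set
EndingDegreeTwo n o =
  ∀ k → 2 ≤ k → k ≤ n →
    (degree o k (proj₁ (endingVertices o k)) ≡ 2) ×
    (degree o k (proj₂ (endingVertices o k)) ≡ 2)

EdgeAdjacent : Cell → Cell → Set
EdgeAdjacent (a , b) (c , d) =
  ((c ≡ a +ℤ + 1) × (d ≡ b)) ⊎' ((a ≡ c +ℤ + 1) × (d ≡ b)) ⊎'
  ((d ≡ b +ℤ + 1) × (c ≡ a)) ⊎' ((b ≡ d +ℤ + 1) × (c ≡ a))
  where
    open import Data.Sum using () renaming (_⊎_ to _⊎'_)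

Free : Placement → ℕ → Cell → Set
Free o n c = ∀ i → 1 ≤ i → i ≤ n → ¬ (pos o i ≡ c)

-- cell c lies in the unbounded face: it can be joined, through free cells
-- crossing sides that are not edges of the graph, to a cell lying strictly
-- to the right of all placed squares.
data Escapes (o : Placement) (n : ℕ) : Cell → Set where
  far  : ∀ c → (∀ i → 1 ≤ i → i ≤ n → proj₁ (pos o i) <ℤ proj₁ c) → Escapes o n c
  step : ∀ c c' → Free o n c' → EdgeAdjacent c c' → Escapes o n c' → Escapes o n c

-- The squares 1..n form a general polyomino chain (with inner dual the path
-- 1 - 2 - ... - n): the squares are pairwise distinct, the bounded faces
-- of the graph are exactly the placed squares (no free cell is enclosed),
-- and two squares share a side only if they are consecutive.
GeneralPolyominoChain : ℕ → Placement → Set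
GeneralPolyominoChain n o =
  (∀ i j → 1 ≤ i → i < j → j ≤ n → ¬ (pos o i ≡ pos o j)) ×
  (∀ i j → 1 ≤ i → suc i < j → j ≤ n → ¬ EdgeAdjacent (pos o i) (pos o j)) ×
  (∀ c → Free o n c → Escapes o n c)

{-# OPTIONS --safe #-}
-- Two local facts drive the proof. A link in {1,2,3} never sends a square back onto its
-- predecessor, and if both ending vertices of square k have degree 2, then the five cells
-- other than square k of the 2 × 3 block formed by square k, the cell ahead of it and
-- their side neighbours are empty when square k is placed. Every neighbour of square k
-- other than square k - 1 lies in that block, so squares never repeat and only consecutive
-- squares share a side. For the outer face, add the squares one at a time: an escape path
-- that crosses the new square enters and leaves it through cells of the block (or leaves
-- it to the right, when it escaped from there directly), and the empty block is a path
-- around the new square along which it can be rerouted.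
module Submission where

open import Defs
open import Data.Nat using (ℕ; zero; suc; _+_; _≤_; _<_; z≤n; s≤s)
import Data.Nat.Properties as ℕP
open import Data.Integer as ℤ using (ℤ; +_; -[1+_]; ∣_∣)
  renaming (_+_ to _+ℤ_; _-_ to _-ℤ_; _<_ to _<ℤ_; _≤_ to _≤ℤ_)
import Data.Integer.Properties as ℤP
open import Data.Integer.Tactic.RingSolver using (solve-∀)
open import Data.Bool using (true; false; _∨_; if_then_else_)
open import Data.Bool.Properties using (∨-zeroʳ)
open import Data.Product using (_×_; _,_; proj₁; proj₂; ∃-syntax)
open import Data.Product.Properties using (≡-dec)
open import Data.Sum using (_⊎_; inj₁; inj₂)
open import Data.Empty using (⊥; ⊥-elim)
open import Function using (_∘_)
open import Relation.Nullary using (¬_; yes; no)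
open import Relation.Binary.PropositionalEquality
  using (_≡_; _≢_; refl; sym; trans; cong; cong₂; subst)

x+1-1≡x : ∀ x → (x +ℤ + 1) -ℤ + 1 ≡ x
x+1-1≡x = solve-∀

x-1+1≡x : ∀ x → (x -ℤ + 1) +ℤ + 1 ≡ x
x-1+1≡x = solve-∀

x≡y+[x-y] : ∀ x y → x ≡ y +ℤ (x -ℤ y)
x≡y+[x-y] = solve-∀

x<x+1 : ∀ x → x <ℤ x +ℤ + 1
x<x+1 x = ℤP.suc[i]≤j⇒i<j (ℤP.≤-reflexive (ℤP.+-comm (+ 1) x))

x+1≢x : ∀ x → x +ℤ + 1 ≢ x
x+1≢x x eq = ℤP.i≢suc[i] (sym (trans (ℤP.+-comm (+ 1) x) eq))

x-1≢x : ∀ x → x -ℤ + 1 ≢ x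
x-1≢x x eq = x+1≢x x (trans (cong (_+ℤ + 1) (sym eq)) (x-1+1≡x x))

i≤+∣i∣ : ∀ i → i ≤ℤ + ∣ i ∣
i≤+∣i∣ (+ n)    = ℤP.≤-refl
i≤+∣i∣ -[1+ n ] = ℤ.-≤+

x+[1+t]≡[x+1]+t : ∀ x t → x +ℤ + suc t ≡ (x +ℤ + 1) +ℤ + t
x+[1+t]≡[x+1]+t x t = trans (cong (x +ℤ_) (ℤP.pos-+ 1 t)) (sym (ℤP.+-assoc x (+ 1) (+ t)))

exceeds : ∀ a x → a <ℤ x +ℤ + suc ∣ a -ℤ x ∣
exceeds a x = begin-strict
  a                     ≡⟨ x≡y+[x-y] a x ⟩
  x +ℤ (a -ℤ x)         ≤⟨ ℤP.+-monoʳ-≤ x (i≤+∣i∣ (a -ℤ x)) ⟩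
  x +ℤ + ∣ a -ℤ x ∣     <⟨ ℤP.+-monoʳ-< x (ℤ.+<+ (ℕP.n<1+n _)) ⟩
  x +ℤ + suc ∣ a -ℤ x ∣ ∎
  where open ℤP.≤-Reasoning

opp : Orient → Orient
opp R = L
opp L = R
opp U = D
opp D = U

opp-involutive : ∀ d → opp (opp d) ≡ d
opp-involutive R = refl
opp-involutive L = refl
opp-involutive U = refl
opp-involutive D = refl

data Sign : Set where
  plus minus : Sign

perp : Sign → Orient → Orient
perp plus  R = U
perp plus  L = U
perp plus  U = R
perp plus  D = R
perp minus R = D
perp minus L = D
perp minus U = L
perp minus D = L

data Relative (d : Orient) : Orient → Set where
  opposite : Relative d (opp d)
  straight : Relative d d
  turn     : ∀ s → Relative d (perp s d)

relative : ∀ d e → Relative d e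
relative R R = straight
relative R L = opposite
relative R U = turn plus
relative R D = turn minus
relative L R = opposite
relative L L = straight
relative L U = turn plus
relative L D = turn minus
relative U R = turn plus
relative U L = turn minus
relative U U = straight
relative U D = opposite
relative D R = turn plus
relative D L = turn minus
relative D U = opposite
relative D D = straight

move-opp : ∀ d c → move (opp d) (move d c) ≡ c
move-opp R (x , y) = cong (_, y) (x+1-1≡x x)
move-opp L (x , y) = cong (_, y) (x-1+1≡x x)
move-opp U (x , y) = cong (x ,_) (x+1-1≡x y)
move-opp D (x , y) = cong (x ,_) (x-1+1≡x y)

move≢ : ∀ d c → move d c ≢ c
move≢ R (x , y) = x+1≢x x ∘ cong proj₁
move≢ L (x , y) = x-1≢x x ∘ cong proj₁
move≢ U (x , y) = x+1≢x y ∘ cong proj₂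
move≢ D (x , y) = x-1≢x y ∘ cong proj₂

move-perp-comm : ∀ s d c → move d (move (perp s d) c) ≡ move (perp s d) (move d c)
move-perp-comm plus  R c = refl
move-perp-comm plus  L c = refl
move-perp-comm plus  U c = refl
move-perp-comm plus  D c = refl
move-perp-comm minus R c = refl
move-perp-comm minus L c = refl
move-perp-comm minus U c = refl
move-perp-comm minus D c = refl

adjacent-sym : ∀ {c c'} → EdgeAdjacent c c' → EdgeAdjacent c' c
adjacent-sym (inj₁ (eq₁ , eq₂))               = inj₂ (inj₁ (eq₁ , sym eq₂))
adjacent-sym (inj₂ (inj₁ (eq₁ , eq₂)))        = inj₁ (eq₁ , sym eq₂)
adjacent-sym (inj₂ (inj₂ (inj₁ (eq₁ , eq₂)))) = inj₂ (inj₂ (inj₂ (eq₁ , sym eq₂)))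
adjacent-sym (inj₂ (inj₂ (inj₂ (eq₁ , eq₂)))) = inj₂ (inj₂ (inj₁ (eq₁ , sym eq₂)))

adjacent-move : ∀ d c → EdgeAdjacent c (move d c)
adjacent-move R (x , y) = inj₁ (refl , refl)
adjacent-move L (x , y) = inj₂ (inj₁ (sym (x-1+1≡x x) , refl))
adjacent-move U (x , y) = inj₂ (inj₂ (inj₁ (refl , refl)))
adjacent-move D (x , y) = inj₂ (inj₂ (inj₂ (sym (x-1+1≡x y) , refl)))

adjacent⇒move : ∀ {c c'} → EdgeAdjacent c c' → ∃[ d ] (c ≡ move d c')
adjacent⇒move {x , y} (inj₁ (x'≡x+1 , y'≡y)) =
  L , cong₂ _,_ (trans (sym (x+1-1≡x x)) (cong (_-ℤ + 1) (sym x'≡x+1))) (sym y'≡y)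
adjacent⇒move (inj₂ (inj₁ (x≡x'+1 , y'≡y))) = R , cong₂ _,_ x≡x'+1 (sym y'≡y)
adjacent⇒move {x , y} (inj₂ (inj₂ (inj₁ (y'≡y+1 , x'≡x)))) =
  D , cong₂ _,_ (sym x'≡x) (trans (sym (x+1-1≡x y)) (cong (_-ℤ + 1) (sym y'≡y+1)))
adjacent⇒move (inj₂ (inj₂ (inj₂ (y≡y'+1 , x'≡x)))) = U , cong₂ _,_ (sym x'≡x) y≡y'+1

data Front (d : Orient) (c : Cell) : Cell → Set where
  ahead    : Front d c (move d c)
  beside   : ∀ s → Front d c (move (perp s d) c)
  diagonal : ∀ s → Front d c (move d (move (perp s d) c))

Far : Placement → ℕ → Cell → Set
Far o m c = ∀ i → 1 ≤ i → i ≤ m → proj₁ (pos o i) <ℤ proj₁ c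

module _ {o : Placement} where

  free-pred : ∀ {m c} → Free o (suc m) c → Free o m c
  free-pred c-free i 1≤i i≤m = c-free i 1≤i (ℕP.m≤n⇒m≤1+n i≤m)

  free-suc : ∀ {m c} → Free o m c → pos o (suc m) ≢ c → Free o (suc m) c
  free-suc c-free new≢c i 1≤i i≤1+m with ℕP.m≤n⇒m<n∨m≡n i≤1+m
  ... | inj₁ (s≤s i≤m) = c-free i 1≤i i≤m
  ... | inj₂ refl      = new≢c

  far-zero : ∀ {c} → Far o 0 c
  far-zero (suc i) _ ()

  Far⇒Free : ∀ {m c} → Far o m c → Free o m c
  Far⇒Free c-far i 1≤i i≤m eq = ℤP.<-irrefl (cong proj₁ eq) (c-far i 1≤i i≤m)

  far-suc : ∀ {m c} → Far o m c → proj₁ (pos o (suc m)) <ℤ proj₁ c → Far o (suc m) c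
  far-suc c-far new<c i 1≤i i≤1+m with ℕP.m≤n⇒m<n∨m≡n i≤1+m
  ... | inj₁ (s≤s i≤m) = c-far i 1≤i i≤m
  ... | inj₂ refl      = new<c

  far-right : ∀ {m c} → Far o m c → Far o m (move R c)
  far-right c-far i 1≤i i≤m = ℤP.<-trans (c-far i 1≤i i≤m) (x<x+1 _)

  module _ {m : ℕ} where
    private
      P = pos o (suc m)

    walk-right : ∀ t {x y} → y ≢ proj₂ P → Far o m (x , y) → proj₁ P <ℤ x +ℤ + t →
                 Escapes o (suc m) (x , y)
    walk-right zero {x} {y} y≢ c-far P<x =
      far _ (far-suc {c = x , y} c-far (subst (proj₁ P <ℤ_) (ℤP.+-identityʳ x) P<x))
    walk-right (suc t) {x} {y} y≢ c-far P<x =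
      step _ _ (free-suc (Far⇒Free next-far) (y≢ ∘ sym ∘ cong proj₂)) (adjacent-move R _)
        (walk-right t y≢ next-far (subst (proj₁ P <ℤ_) (x+[1+t]≡[x+1]+t x t) P<x))
      where
      next-far : Far o m (x +ℤ + 1 , y)
      next-far = far-right {c = x , y} c-far

    far⇒escapes-suc : ∀ {c} → Far o m c → Escapes o (suc m) c
    far⇒escapes-suc {x , y} c-far with y ℤP.≟ proj₂ P
    ... | no y≢  = walk-right _ y≢ c-far (exceeds _ x)
    ... | yes refl =
      step _ _ (free-suc (Far⇒Free c-far) (y+1≢ ∘ sym ∘ cong proj₂)) (adjacent-move U _)
        (walk-right _ y+1≢ c-far (exceeds _ x))
      where y+1≢ = x+1≢x (proj₂ P)

module Detour {o : Placement} {k : ℕ} {d : Orient} {c : Cell}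
  (clear : ∀ {q} → Front d c q → Free o k q) where

  to-ahead : ∀ {a} → a ≢ opp d → Escapes o k (move a c) → Escapes o k (move d c)
  to-ahead {a} a≢ E with relative d a
  ... | opposite = ⊥-elim (a≢ refl)
  ... | straight = E
  ... | turn s   =
    step _ _ (clear (diagonal s))
      (subst (EdgeAdjacent (move d c)) (sym (move-perp-comm s d c)) (adjacent-move (perp s d) _))
      (step _ _ (clear (beside s)) (adjacent-sym (adjacent-move d _)) E)

  from-ahead : ∀ {a} → a ≢ opp d → Escapes o k (move d c) → Escapes o k (move a c)
  from-ahead {a} a≢ E with relative d a
  ... | opposite = ⊥-elim (a≢ refl)
  ... | straight = E
  ... | turn s   =
    step _ _ (clear (diagonal s)) (adjacent-move d _)
      (step _ _ (clear ahead)
        (subst (λ q → EdgeAdjacent q (move d c)) (sym (move-perp-comm s d c))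
          (adjacent-sym (adjacent-move (perp s d) _)))
        E)

  detour : ∀ {a b} → a ≢ opp d → b ≢ opp d → Escapes o k (move b c) → Escapes o k (move a c)
  detour a≢ b≢ = from-ahead a≢ ∘ to-ahead b≢

=ℤ-refl : ∀ a → (a =ℤ a) ≡ true
=ℤ-refl a with a ℤP.≟ a
... | yes _  = refl
... | no a≢a = ⊥-elim (a≢a refl)

data Side : Seg → Cell → Set where
  bottom : ∀ {x y x' y'} → x' ≡ x → y' ≡ y → Side (hseg (x' , y')) (x , y)
  top    : ∀ {x y x' y'} → x' ≡ x → y' ≡ y +ℤ + 1 → Side (hseg (x' , y')) (x , y)
  left   : ∀ {x y x' y'} → x' ≡ x → y' ≡ y → Side (vseg (x' , y')) (x , y)
  right  : ∀ {x y x' y'} → x' ≡ x +ℤ + 1 → y' ≡ y → Side (vseg (x' , y')) (x , y)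

Side⇒isSideOf : ∀ {s c} → Side s c → isSideOf s c ≡ true
Side⇒isSideOf (bottom {x} {y} refl refl) rewrite =ℤ-refl x | =ℤ-refl y = refl
Side⇒isSideOf (top {x} {y} refl refl) rewrite =ℤ-refl x | =ℤ-refl (y +ℤ + 1) = ∨-zeroʳ _
Side⇒isSideOf (left {x} {y} refl refl) rewrite =ℤ-refl x | =ℤ-refl y = refl
Side⇒isSideOf (right {x} {y} refl refl) rewrite =ℤ-refl (x +ℤ + 1) | =ℤ-refl y = ∨-zeroʳ _

anyUpTo-intro : ∀ f {k i} → 1 ≤ i → i ≤ k → f i ≡ true → anyUpTo f k ≡ true
anyUpTo-intro f {zero} (s≤s _) ()
anyUpTo-intro f {suc k} 1≤i i≤1+k fi with ℕP.m≤n⇒m<n∨m≡n i≤1+k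
... | inj₂ refl      = cong (_∨ anyUpTo f k) fi
... | inj₁ (s≤s i≤k) = trans (cong (f (suc k) ∨_) (anyUpTo-intro f 1≤i i≤k fi)) (∨-zeroʳ _)

sum≡2⇒¬abc : ∀ {a b c d} → b2n a + b2n b + b2n c + b2n d ≡ 2 →
  a ≡ true → b ≡ true → c ≡ true → ⊥
sum≡2⇒¬abc {d = true}  () refl refl refl
sum≡2⇒¬abc {d = false} () refl refl refl

sum≡2⇒¬abd : ∀ {a b c d} → b2n a + b2n b + b2n c + b2n d ≡ 2 →
  a ≡ true → b ≡ true → d ≡ true → ⊥
sum≡2⇒¬abd {c = true}  () refl refl refl
sum≡2⇒¬abd {c = false} () refl refl refl

sum≡2⇒¬acd : ∀ {a b c d} → b2n a + b2n b + b2n c + b2n d ≡ 2 →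
  a ≡ true → c ≡ true → d ≡ true → ⊥
sum≡2⇒¬acd {b = true}  () refl refl refl
sum≡2⇒¬acd {b = false} () refl refl refl

sum≡2⇒¬bcd : ∀ {a b c d} → b2n a + b2n b + b2n c + b2n d ≡ 2 →
  b ≡ true → c ≡ true → d ≡ true → ⊥
sum≡2⇒¬bcd {a = true}  () refl refl refl
sum≡2⇒¬bcd {a = false} () refl refl refl

Placed : Placement → ℕ → Cell → Set
Placed o k c = ∃[ i ] (1 ≤ i × i ≤ k × pos o i ≡ c)

cornersAhead : Orient → Cell → Point × Point
cornersAhead R (x , y) = (x +ℤ + 1 , y) , (x +ℤ + 1 , y +ℤ + 1)
cornersAhead L (x , y) = (x , y) , (x , y +ℤ + 1)
cornersAhead U (x , y) = (x , y +ℤ + 1) , (x +ℤ + 1 , y +ℤ + 1)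
cornersAhead D (x , y) = (x , y) , (x +ℤ + 1 , y)

endingVertices≡cornersAhead : ∀ o k → endingVertices o k ≡ cornersAhead (o k) (pos o k)
endingVertices≡cornersAhead o k with o k | pos o k
... | R | (x , y) = refl
... | L | (x , y) = refl
... | U | (x , y) = refl
... | D | (x , y) = refl

module _ (o : Placement) (k : ℕ) where

  data Edge (s : Seg) : Set where
    edge : ∀ {c} → Placed o k c → Side s c → Edge s

  Edge⇒isEdge : ∀ {s} → Edge s → isEdge o k s ≡ true
  Edge⇒isEdge (edge (i , 1≤i , i≤k , refl) side) = anyUpTo-intro _ 1≤i i≤k (Side⇒isSideOf side)

  module _ {x y : ℤ} (deg≡2 : degree o k (x , y) ≡ 2) where

    ¬→←↑ : Edge (hseg (x , y)) → Edge (hseg (x -ℤ + 1 , y)) → Edge (vseg (x , y)) → ⊥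
    ¬→←↑ e₁ e₂ e₃ =
      sum≡2⇒¬abc deg≡2 (Edge⇒isEdge e₁) (Edge⇒isEdge e₂) (Edge⇒isEdge e₃)

    ¬→←↓ : Edge (hseg (x , y)) → Edge (hseg (x -ℤ + 1 , y)) → Edge (vseg (x , y -ℤ + 1)) → ⊥
    ¬→←↓ e₁ e₂ e₄ =
      sum≡2⇒¬abd deg≡2 (Edge⇒isEdge e₁) (Edge⇒isEdge e₂) (Edge⇒isEdge e₄)

    ¬→↑↓ : Edge (hseg (x , y)) → Edge (vseg (x , y)) → Edge (vseg (x , y -ℤ + 1)) → ⊥
    ¬→↑↓ e₁ e₃ e₄ =
      sum≡2⇒¬acd deg≡2 (Edge⇒isEdge e₁) (Edge⇒isEdge e₃) (Edge⇒isEdge e₄)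

    ¬←↑↓ : Edge (hseg (x -ℤ + 1 , y)) → Edge (vseg (x , y)) → Edge (vseg (x , y -ℤ + 1)) → ⊥
    ¬←↑↓ e₂ e₃ e₄ =
      sum≡2⇒¬bcd deg≡2 (Edge⇒isEdge e₂) (Edge⇒isEdge e₃) (Edge⇒isEdge e₄)

  -- A square on a front cell would add a third edge at one of the two corners ahead.
  ending-front-clear : ∀ d {c q} → Placed o k c →
    degree o k (proj₁ (cornersAhead d c)) ≡ 2 → degree o k (proj₂ (cornersAhead d c)) ≡ 2 →
    Front d c q → ¬ Placed o k q
  ending-front-clear R {x , y} P d₁ d₂ ahead Q =
    ¬→←↑ d₁ (edge Q (bottom refl refl)) (edge P (bottom (x+1-1≡x x) refl))
      (edge P (right refl refl))
  ending-front-clear R {x , y} P d₁ d₂ (beside plus) Q =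
    ¬←↑↓ d₂ (edge P (top (x+1-1≡x x) refl)) (edge Q (right refl refl))
      (edge P (right refl (x+1-1≡x y)))
  ending-front-clear R {x , y} P d₁ d₂ (beside minus) Q =
    ¬←↑↓ d₁ (edge P (bottom (x+1-1≡x x) refl)) (edge P (right refl refl))
      (edge Q (right refl refl))
  ending-front-clear R {x , y} P d₁ d₂ (diagonal plus) Q =
    ¬→←↓ d₂ (edge Q (bottom refl refl)) (edge P (top (x+1-1≡x x) refl))
      (edge P (right refl (x+1-1≡x y)))
  ending-front-clear R {x , y} P d₁ d₂ (diagonal minus) Q =
    ¬←↑↓ d₁ (edge P (bottom (x+1-1≡x x) refl)) (edge P (right refl refl))
      (edge Q (left refl refl))
  ending-front-clear L {x , y} P d₁ d₂ ahead Q =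
    ¬→←↑ d₁ (edge P (bottom refl refl)) (edge Q (bottom refl refl))
      (edge P (left refl refl))
  ending-front-clear L {x , y} P d₁ d₂ (beside plus) Q =
    ¬→↑↓ d₂ (edge P (top refl refl)) (edge Q (left refl refl))
      (edge P (left refl (x+1-1≡x y)))
  ending-front-clear L {x , y} P d₁ d₂ (beside minus) Q =
    ¬→↑↓ d₁ (edge P (bottom refl refl)) (edge P (left refl refl))
      (edge Q (left refl refl))
  ending-front-clear L {x , y} P d₁ d₂ (diagonal plus) Q =
    ¬→←↓ d₂ (edge P (top refl refl)) (edge Q (bottom refl refl))
      (edge P (left refl (x+1-1≡x y)))
  ending-front-clear L {x , y} P d₁ d₂ (diagonal minus) Q =
    ¬→↑↓ d₁ (edge P (bottom refl refl)) (edge P (left refl refl))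
      (edge Q (right (sym (x-1+1≡x x)) refl))
  ending-front-clear U {x , y} P d₁ d₂ ahead Q =
    ¬→↑↓ d₁ (edge P (top refl refl)) (edge Q (left refl refl))
      (edge P (left refl (x+1-1≡x y)))
  ending-front-clear U {x , y} P d₁ d₂ (beside plus) Q =
    ¬→←↓ d₂ (edge Q (top refl refl)) (edge P (top (x+1-1≡x x) refl))
      (edge P (right refl (x+1-1≡x y)))
  ending-front-clear U {x , y} P d₁ d₂ (beside minus) Q =
    ¬→←↓ d₁ (edge P (top refl refl)) (edge Q (top refl refl))
      (edge P (left refl (x+1-1≡x y)))
  ending-front-clear U {x , y} P d₁ d₂ (diagonal plus) Q =
    ¬←↑↓ d₂ (edge P (top (x+1-1≡x x) refl)) (edge Q (left refl refl))
      (edge P (right refl (x+1-1≡x y)))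
  ending-front-clear U {x , y} P d₁ d₂ (diagonal minus) Q =
    ¬→←↓ d₁ (edge P (top refl refl)) (edge Q (bottom refl refl))
      (edge P (left refl (x+1-1≡x y)))
  ending-front-clear D {x , y} P d₁ d₂ ahead Q =
    ¬→↑↓ d₁ (edge P (bottom refl refl)) (edge P (left refl refl))
      (edge Q (left refl refl))
  ending-front-clear D {x , y} P d₁ d₂ (beside plus) Q =
    ¬→←↑ d₂ (edge Q (bottom refl refl)) (edge P (bottom (x+1-1≡x x) refl))
      (edge P (right refl refl))
  ending-front-clear D {x , y} P d₁ d₂ (beside minus) Q =
    ¬→←↑ d₁ (edge P (bottom refl refl)) (edge Q (bottom refl refl))
      (edge P (left refl refl))
  ending-front-clear D {x , y} P d₁ d₂ (diagonal plus) Q =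
    ¬←↑↓ d₂ (edge P (bottom (x+1-1≡x x) refl)) (edge P (right refl refl))
      (edge Q (left refl refl))
  ending-front-clear D {x , y} P d₁ d₂ (diagonal minus) Q =
    ¬→←↑ d₁ (edge P (bottom refl refl)) (edge Q (top refl (sym (x-1+1≡x y))))
      (edge P (left refl refl))

NoReversal : ℕ → Placement → Set
NoReversal n o = ∀ i → 2 ≤ i → suc i ≤ n → o (suc i) ≢ opp (o i)

ClearFronts : ℕ → Placement → Set
ClearFronts n o = ∀ k → 2 ≤ k → k ≤ n → ∀ {q} → Front (o k) (pos o k) q → Free o k q

pos-suc : ∀ o {i} → 1 ≤ i → pos o (suc i) ≡ move (o (suc i)) (pos o i)
pos-suc o {suc i} _ = refl

pos-behind : ∀ o {i e} → 1 ≤ i → e ≡ opp (o (suc i)) → move e (pos o (suc i)) ≡ pos o i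
pos-behind o {i} 1≤i refl =
  trans (cong (move (opp (o (suc i)))) (pos-suc o 1≤i)) (move-opp (o (suc i)) (pos o i))

module Chain {n : ℕ} {o : Placement} (no-reversal : NoReversal n o) (clear : ClearFronts n o) where

  behind-or-free : ∀ {j} → 1 ≤ j → suc j ≤ n → ∀ e →
                   e ≡ opp (o (suc j)) ⊎ Free o (suc j) (move e (pos o (suc j)))
  behind-or-free {j} 1≤j j<n e with relative (o (suc j)) e
  ... | opposite = inj₁ refl
  ... | straight = inj₂ (clear (suc j) (s≤s 1≤j) j<n ahead)
  ... | turn s   = inj₂ (clear (suc j) (s≤s 1≤j) j<n (beside s))

  distinct : ∀ {i j} → 1 ≤ i → i < j → j ≤ n → pos o i ≢ pos o j
  distinct {i} {suc j} 1≤i (s≤s i≤j) j<n eq with ℕP.m≤n⇒m<n∨m≡n i≤j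
  ... | inj₂ refl = move≢ (o (suc i)) (pos o i) (sym (trans eq (pos-suc o 1≤i)))
  ... | inj₁ i<j  = clash (behind-or-free 1≤j j<n (o (suc i)))
    where
    1≤j = ℕP.≤-trans 1≤i (ℕP.<⇒≤ i<j)

    next-at : pos o (suc i) ≡ move (o (suc i)) (pos o (suc j))
    next-at = trans (pos-suc o 1≤i) (cong (move (o (suc i))) eq)

    clash : o (suc i) ≡ opp (o (suc j)) ⊎ Free o (suc j) (move (o (suc i)) (pos o (suc j))) → ⊥
    clash (inj₂ free) = free (suc i) (s≤s z≤n) (s≤s (ℕP.<⇒≤ i<j)) next-at
    clash (inj₁ back) with ℕP.m≤n⇒m<n∨m≡n i<j
    ... | inj₁ 1+i<j = distinct (s≤s z≤n) 1+i<j (ℕP.≤-trans (ℕP.n≤1+n j) j<n)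
                         (trans next-at (pos-behind o 1≤j back))
    ... | inj₂ refl  = no-reversal (suc i) (s≤s 1≤i) j<n
                         (trans (sym (opp-involutive _)) (cong opp (sym back)))

  non-adjacent : ∀ {i j} → 1 ≤ i → suc i < j → j ≤ n → ¬ EdgeAdjacent (pos o i) (pos o j)
  non-adjacent {i} {suc j} 1≤i (s≤s i<j) j<n adj = clash (behind-or-free 1≤j j<n e)
    where
    1≤j = ℕP.≤-trans 1≤i (ℕP.<⇒≤ i<j)
    e = proj₁ (adjacent⇒move adj)
    i-at = proj₂ (adjacent⇒move adj)

    clash : e ≡ opp (o (suc j)) ⊎ Free o (suc j) (move e (pos o (suc j))) → ⊥
    clash (inj₁ back) =
      distinct 1≤i i<j (ℕP.≤-trans (ℕP.n≤1+n j) j<n) (trans i-at (pos-behind o 1≤j back))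
    clash (inj₂ free) = free i 1≤i (ℕP.≤-trans (ℕP.<⇒≤ i<j) (ℕP.n≤1+n j)) i-at

  module _ {m} (1≤m : 1 ≤ m) (m<n : suc m ≤ n) where
    private
      d = o (suc m)
      P = pos o (suc m)
      open Detour (clear (suc m) (s≤s 1≤m) m<n)

    not-behind : ∀ {a} → pos o m ≢ move a P → a ≢ opp d
    not-behind pos-m≢ behind = pos-m≢ (sym (pos-behind o 1≤m behind))

    far-not-behind : proj₁ (pos o m) <ℤ proj₁ P → R ≢ opp d
    far-not-behind m<P behind = ℤP.<-asym (x<x+1 (proj₁ P))
      (subst (λ c → proj₁ c <ℤ proj₁ P) (sym (pos-behind o 1≤m behind)) m<P)

    mutual
      escapes-suc : ∀ {c} → Free o (suc m) c → Escapes o m c → Escapes o (suc m) c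
      escapes-suc _ (far _ c-far) = far⇒escapes-suc c-far
      escapes-suc c-free (step _ c' c'-free adj E) with ≡-dec ℤP._≟_ ℤP._≟_ c' P
      ... | no c'≢P  = step _ c' c'-free⁺ adj (escapes-suc c'-free⁺ E)
        where c'-free⁺ = free-suc c'-free (c'≢P ∘ sym)
      ... | yes refl = through-P c-free (proj₂ (adjacent⇒move adj)) E

      through-P : ∀ {a c} → Free o (suc m) c → c ≡ move a P → Escapes o m P → Escapes o (suc m) c
      through-P c-free refl (far _ P-far) =
        detour (not-behind (c-free m 1≤m (ℕP.n≤1+n m)))
               (far-not-behind (P-far m 1≤m ℕP.≤-refl))
               (far⇒escapes-suc (far-right {c = P} P-far))
      through-P c-free refl (step _ c'' c''-free adj E) with adjacent⇒move (adjacent-sym adj)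
      ... | b , refl =
        detour (not-behind (c-free m 1≤m (ℕP.n≤1+n m)))
               (not-behind (c''-free m 1≤m ℕP.≤-refl))
               (escapes-suc (free-suc c''-free (move≢ b P ∘ sym)) E)

  escapes : ∀ {m c} → 1 ≤ m → m ≤ n → Free o m c → Escapes o m c
  escapes {suc zero} {c} _ _ _ = far⇒escapes-suc (far-zero {c = c})
  escapes {suc (suc m)} _ m<n c-free =
    escapes-suc (s≤s z≤n) m<n c-free
      (escapes (s≤s z≤n) (ℕP.≤-trans (ℕP.n≤1+n _) m<n) (free-pred c-free))

  polyomino-chain : 1 ≤ n → GeneralPolyominoChain n o
  polyomino-chain 1≤n =
    (λ _ _ → distinct) , (λ _ _ → non-adjacent) , (λ _ → escapes 1≤n ℕP.≤-refl)

linkOf-reversal : ∀ o i → o (suc i) ≡ opp (o i) → linkOf o i ≡ 0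
linkOf-reversal o i = reversal-test (o i) (o (suc i))
  where
  reversal-test : ∀ a b {r} → b ≡ opp a → (if b =O a then 1 else if dir b =D dir a then 0 else r) ≡ 0
  reversal-test R .L refl = refl
  reversal-test L .R refl = refl
  reversal-test U .D refl = refl
  reversal-test D .U refl = refl

link≢0 : ∀ {m} → (m ≡ 1) ⊎ (m ≡ 2) ⊎ (m ≡ 3) → m ≢ 0
link≢0 (inj₁ refl)        ()
link≢0 (inj₂ (inj₁ refl)) ()
link≢0 (inj₂ (inj₂ refl)) ()

links⇒NoReversal : ∀ {n Lk o} →
  (∀ k → 3 ≤ k → k ≤ n → (Lk k ≡ 1) ⊎ (Lk k ≡ 2) ⊎ (Lk k ≡ 3)) → Follows n Lk o → NoReversal n o
links⇒NoReversal {o = o} links (_ , follows) i 2≤i i<n rev =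
  link≢0 (links (suc i) (s≤s 2≤i) i<n) (trans (sym (follows i 2≤i i<n)) (linkOf-reversal o i rev))

EndingDegreeTwo⇒ClearFronts : ∀ {n o} → EndingDegreeTwo n o → ClearFronts n o
EndingDegreeTwo⇒ClearFronts {o = o} ending k 2≤k k≤n front i 1≤i i≤k i-at =
  ending-front-clear o k (o k) (k , 1≤k , ℕP.≤-refl , refl) (proj₁ degrees) (proj₂ degrees) front
    (i , 1≤i , i≤k , i-at)
  where
  1≤k = ℕP.≤-trans (s≤s z≤n) 2≤k
  degrees = subst (λ v → degree o k (proj₁ v) ≡ 2 × degree o k (proj₂ v) ≡ 2)
                  (endingVertices≡cornersAhead o k) (ending k 2≤k k≤n)

lemma2p1 : (n : ℕ) → 3 ≤ n → (Lk : ℕ → ℕ) → Lk 1 ≡ 1 → Lk 2 ≡ 1 →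
    (∀ k → 3 ≤ k → k ≤ n → (Lk k ≡ 1) ⊎ (Lk k ≡ 2) ⊎ (Lk k ≡ 3)) →
    (o : Placement) → Follows n Lk o → EndingDegreeTwo n o →
    GeneralPolyominoChain n o
lemma2p1 _ 3≤n _ _ _ links _ follows ending =
  Chain.polyomino-chain (links⇒NoReversal links follows) (EndingDegreeTwo⇒ClearFronts ending)
    (ℕP.≤-trans (s≤s z≤n) 3≤n)
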